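{- Let $\approx$ be an SCER on $\Sigma^*$ and $T$ a string of length $n$. For any $1\le i\le n$, $\mathit{LCover}_T[i]=\mathsf{LongestLSeedCov}_T(i,\mathit{Border}_T[i])$.
   Context: $\Sigma^*$ is the set of strings over an alphabet $\Sigma$. For a string $T$, $|T|$ is its length, $T[i:j]$ the substring from position $i$ to $j$, $T[:j]=T[1:j]$ ($T[:0]$ is empty), $T[i:]=T[i:|T|]$. An SCER is an equivalence relation $\approx$ on $\Sigma^*$ such that $X\approx Y$ implies $|X|=|Y|$ and $X[i:j]\approx Y[i:j]$ for all $1\le i\le j\le|X|$. $\mathsf{Occ}_{P,T}=\{\,i : 1\le i\le |T|-|P|+1,\ P\approx T[i:i+|P|-1]\,\}$. A string $B$ is a $\approx$-border of $T$ if $B\approx T[:|B|]\approx T[|T|-|B|+1:]$; proper if $|B|<|T|$. $\mathit{Border}_T[i]$ is the maximum length of a proper $\approx$-border of $T[:i]$ (the empty string counts). A string $C$ of length $c$ is a $\approx$-cover of $T$ of length $n$ if there are $x_1,\dots,x_m\in\mathsf{Occ}_{C,T}$ with $x_1=1$, $x_m=n-c+1$ and $x_{i-1}<x_i\le x_{i-1}+c$ for all $1<i\le m$; proper if $c<n$; $\mathsf{Cov}_\approx(T)$ is the set of all $\approx$-covers of $T$. $\mathit{LCover}_T[i]=\max(\{\,|C| : C\text{ a proper }\approx\text{ -cover of }T[:i]\,\}\cup\{0\})$. A string $S$ of length $m$ is a left $\approx$-seed of a string $T$ of length $n$ if there exist non-negative integers $k,l$ with $k\le l<m$, $S\in\mathsf{Cov}_\approx(T[:n-k])$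 and $S[:l]\approx T[n-l+1:]$ (here $S[:0]$ and $T[n+1:]$ are empty); $\mathsf{LSeed}_\approx(T)$ is their set. $\mathsf{LongestLSeedCov}_T(i,j)=\max(\{\,l : T[:l]\in\mathsf{LSeed}_\approx(T[:i])\cap\mathsf{Cov}_\approx(T[:j])\,\}\cup\{0\})$. -}

module Defs where

open import Level using (Level)
open import Data.Nat using (ℕ; zero; suc; _+_; _∸_; _≤_; _<_)
open import Data.List using (List; []; _∷_; length; take; drop)
open import Data.Product using (Σ; _×_; ∃; ∃-syntax; _,_)
open import Data.Sum using (_⊎_)
open import Relation.Binary.PropositionalEquality using (_≡_)
open import Relation.Binary.Structures using (IsEquivalence)

-- Strings over an alphabet A are lists; positions are 1-based.

-- T[i:j] (1-based, inclusive).  T[:j] = T[1:j] = take j T,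
-- T[i:] = T[i:|T|]; T[|T|+1:] is empty.
sub : {A : Set} → List A → ℕ → ℕ → List A
sub T i j = take (suc j ∸ i) (drop (i ∸ 1) T)

pre : {A : Set} → List A → ℕ → List A
pre T j = sub T 1 j

suf : {A : Set} → List A → ℕ → List A
suf T i = sub T i (length T)

record SCER (A : Set) : Set₁ where
  field
    _≈_     : List A → List A → Set
    isEquiv : IsEquivalence _≈_
    ≈-len   : ∀ {X Y} → X ≈ Y → length X ≡ length Y
    ≈-sub   : ∀ {X Y} → X ≈ Y → ∀ i j → 1 ≤ i → i ≤ j → j ≤ length X →
              sub X i j ≈ sub Y i j

module _ {A : Set} (R : SCER A) where
  open SCER R

  Occ : List A → List A → ℕ → Set
  Occ P T i = (1 ≤ i) × (i ≤ length T ∸ length P + 1) × (length P ≤ length T)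
              × (P ≈ sub T i (i + length P ∸ 1))

  data Chain (c : ℕ) (O : ℕ → Set) : ℕ → ℕ → Set where
    done : ∀ {x} → Chain c O x x
    step : ∀ {x y z} → x < y → y ≤ x + c → O y → Chain c O y z → Chain c O x z

  Cov : List A → List A → Set
  Cov C T = Occ C T 1 × Chain (length C) (Occ C T) 1 (length T ∸ length C + 1)

  IsBorder : List A → List A → Set
  IsBorder B T = (B ≈ pre T (length B)) × (pre T (length B) ≈ suf T (length T ∸ length B + 1))

  LSeed : List A → List A → Set
  LSeed S T = ∃[ k ] ∃[ l ] (k ≤ l) × (l < length S)
              × Cov S (pre T (length T ∸ k))
              × (pre S l ≈ suf T (length T ∸ l + 1))

  BorderLen : List A → ℕ → ℕ → Set
  BorderLen T i b = ∃[ B ] (length B ≡ b) × (b < i) × IsBorder B (pre T i)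

  LCoverSet : List A → ℕ → ℕ → Set
  LCoverSet T i c = (c ≡ 0) ⊎ (∃[ C ] (length C ≡ c) × (c < i) × Cov C (pre T i))

  LLSCSet : List A → ℕ → ℕ → ℕ → Set
  LLSCSet T i j l = (l ≡ 0) ⊎ ((l ≤ length T) × LSeed (pre T l) (pre T i)
                               × Cov (pre T l) (pre T j))

IsMax : (ℕ → Set) → ℕ → Set
IsMax P m = P m × (∀ k → P k → k ≤ m)

-- Let b be the longest proper border of T[:i] and d = i − b, so that
-- T[p:q] ≈ T[p+d:q+d] for p ≤ q ≤ b.
-- LCover ≤ LongestLSeedCov: a proper cover C of T[:i] is ≈ to the prefix
-- S = T[:|C|], and since a cover starts and ends at the two ends of T[:i],
-- S is itself a border, so |S| ≤ b.  S covers T[:i], hence is a left seed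
-- (with k = l = 0), and cutting its covering chain at b − |S| + 1 (an
-- occurrence, by shifting the final occurrence back by d) gives a cover of T[:b].
-- LongestLSeedCov ≤ LCover: if S = T[:s] covers T[:b] and T[:i−k] with
-- k < |S| ≤ b, the copy of the cover of T[:b] shifted by d overlaps the cover
-- of T[:i−k], and the two chains join into a cover of T[:i].
module Submission where

open import Defs
open import Data.Nat using (ℕ; zero; suc; _+_; _∸_; _≤_; _<_; _⊓_; z≤n; s≤s)
open import Data.Nat.Properties
open import Data.List using (List; []; _∷_; length; take; drop)
open import Data.List.Properties using (length-take; take-[]; take-take; drop-drop; take-all)
open import Data.Product using (_×_; _,_; proj₁)
open import Data.Sum using (inj₁; inj₂)
open import Relation.Binary.PropositionalEquality
open import Relation.Binary.Structures using (IsEquivalence)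
open import Relation.Nullary using (yes; no)

m∸n+1+n≡1+m : ∀ {m n} → n ≤ m → m ∸ n + 1 + n ≡ suc m
m∸n+1+n≡1+m {m} {n} n≤m =
  trans (cong (_+ n) (+-comm (m ∸ n) 1)) (cong suc (m∸n+n≡m n≤m))

m∸n+1+n∸1≡m : ∀ {m n} → n ≤ m → m ∸ n + 1 + n ∸ 1 ≡ m
m∸n+1+n∸1≡m n≤m = cong (_∸ 1) (m∸n+1+n≡1+m n≤m)

m∸n+1+[o∸m]≡o∸n+1 : ∀ {m n o} → n ≤ m → m ≤ o → m ∸ n + 1 + (o ∸ m) ≡ o ∸ n + 1
m∸n+1+[o∸m]≡o∸n+1 {m} {n} {o} n≤m m≤o = begin
  m ∸ n + 1 + (o ∸ m)   ≡⟨ +-assoc (m ∸ n) 1 (o ∸ m) ⟩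
  m ∸ n + suc (o ∸ m)   ≡⟨ +-suc (m ∸ n) (o ∸ m) ⟩
  suc (m ∸ n + (o ∸ m)) ≡⟨ cong suc (sym (+-∸-comm (o ∸ m) n≤m)) ⟩
  suc (m + (o ∸ m) ∸ n) ≡⟨ cong (λ x → suc (x ∸ n)) (m+[n∸m]≡n m≤o) ⟩
  suc (o ∸ n)           ≡⟨ +-comm 1 (o ∸ n) ⟩
  o ∸ n + 1             ∎
  where open ≡-Reasoning

m∸n+1≤m : ∀ {m n} → 1 ≤ n → n ≤ m → m ∸ n + 1 ≤ m
m∸n+1≤m {m} {n} 1≤n n≤m =
  subst (_≤ m) (+-comm 1 (m ∸ n)) (∸-monoʳ-< {o = 0} 1≤n n≤m)

1+[o∸n]≤o∸m∸p+1+p : ∀ {m n} o p → m ≤ n → suc (o ∸ n) ≤ o ∸ m ∸ p + 1 + p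
1+[o∸n]≤o∸m∸p+1+p {m} {n} o p m≤n = begin
  suc (o ∸ n)           ≤⟨ s≤s (∸-monoʳ-≤ o m≤n) ⟩
  suc (o ∸ m)           ≤⟨ s≤s (m≤n+m∸n (o ∸ m) p) ⟩
  suc (p + (o ∸ m ∸ p)) ≡⟨ cong suc (+-comm p (o ∸ m ∸ p)) ⟩
  suc (o ∸ m ∸ p + p)   ≡⟨ cong (_+ p) (+-comm 1 (o ∸ m ∸ p)) ⟩
  o ∸ m ∸ p + 1 + p     ∎
  where open ≤-Reasoning

module _ {A : Set} where

  drop-take : ∀ m n (xs : List A) → drop m (take n xs) ≡ take (n ∸ m) (drop m xs)
  drop-take zero    n       xs       = refl
  drop-take (suc m) zero    xs       = refl
  drop-take (suc m) (suc n) []       = sym (take-[] (n ∸ m))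
  drop-take (suc m) (suc n) (x ∷ xs) = drop-take m n xs

  sub-sub : ∀ (X : List A) a e p q → q + a ≤ e →
            sub (sub X (suc a) e) (suc p) q ≡ sub X (suc a + p) (a + q)
  sub-sub X a e p q q+a≤e = begin
      take (q ∸ p) (drop p (take (e ∸ a) (drop a X)))
    ≡⟨ cong (take (q ∸ p)) (drop-take p (e ∸ a) (drop a X)) ⟩
      take (q ∸ p) (take (e ∸ a ∸ p) (drop p (drop a X)))
    ≡⟨ take-take (q ∸ p) (e ∸ a ∸ p) _ ⟩
      take ((q ∸ p) ⊓ (e ∸ a ∸ p)) (drop p (drop a X))
    ≡⟨ cong₂ take (m≤n⇒m⊓n≡m (∸-monoˡ-≤ p (m+n≤o⇒m≤o∸n q q+a≤e))) (drop-drop a p X) ⟩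
      take (q ∸ p) (drop (a + p) X)
    ≡⟨ cong (λ n → take n (drop (a + p) X)) (sym ([m+n]∸[m+o]≡n∸o a q p)) ⟩
      take (suc (a + q) ∸ suc (a + p)) (drop (a + p) X)
    ∎
    where open ≡-Reasoning

  sub-empty : ∀ (X : List A) {p q} → q < p → sub X p q ≡ []
  sub-empty X {p} q<p = cong (λ n → take n (drop (p ∸ 1) X)) (m≤n⇒m∸n≡0 q<p)

  length-pre : ∀ (X : List A) {m} → m ≤ length X → length (pre X m) ≡ m
  length-pre X {m} m≤|X| = trans (length-take m X) (m≤n⇒m⊓n≡m m≤|X|)

  pre-length : ∀ (X : List A) → pre X (length X) ≡ X
  pre-length X = take-all (length X) X ≤-refl

  pre-pre : ∀ (X : List A) {m n} → m ≤ n → pre (pre X n) m ≡ pre X m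
  pre-pre X {m} {n} m≤n = trans (take-take m n X) (cong (λ k → take k X) (m≤n⇒m⊓n≡m m≤n))

  sub-pre : ∀ (X : List A) {m p q} → 1 ≤ p → q ≤ m → sub (pre X m) p q ≡ sub X p q
  sub-pre X {m} {suc p} {q} _ q≤m = sub-sub X 0 m p q (subst (_≤ m) (sym (+-identityʳ q)) q≤m)

  suf-pre : ∀ (X : List A) {m p} → 1 ≤ p → m ≤ length X → suf (pre X m) p ≡ sub X p m
  suf-pre X {m} {p} 1≤p m≤|X| =
    trans (cong (sub (pre X m) p) (length-pre X m≤|X|)) (sub-pre X 1≤p ≤-refl)

module _ {A : Set} (R : SCER A) where
  open SCER R
  open IsEquivalence isEquiv renaming (refl to ≈-refl; sym to ≈-sym; trans to ≈-trans)

  Chain-map : ∀ {c O O′ x z} → (∀ {p} → O p → O′ p) → Chain R c O x z → Chain R c O′ x z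
  Chain-map f done               = done
  Chain-map f (step x<y y≤ Oy ch) = step x<y y≤ (f Oy) (Chain-map f ch)

  Chain-shift : ∀ {c O O′ x z} d → (∀ {p} → O p → O′ (p + d)) →
                Chain R c O x z → Chain R c O′ (x + d) (z + d)
  Chain-shift d f done = done
  Chain-shift {c} d f (step {x} x<y y≤x+c Oy ch) =
    step (+-monoˡ-< d x<y) (≤-trans (+-monoˡ-≤ d y≤x+c) (≤-reflexive x+c+d≡x+d+c))
         (f Oy) (Chain-shift d f ch)
    where
    x+c+d≡x+d+c : x + c + d ≡ x + d + c
    x+c+d≡x+d+c = trans (+-assoc x c d) (trans (cong (x +_) (+-comm c d)) (sym (+-assoc x d c)))

  Chain-last : ∀ {c O x z} → O x → Chain R c O x z → O z
  Chain-last Ox done             = Ox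
  Chain-last _  (step _ _ Oy ch) = Chain-last Oy ch

  -- The joined chain leaves the first one at its last point before y′.
  Chain-join : ∀ {c O x y y′ z} → Chain R c O x y → x < y′ → y′ ≤ y + c → O y′ →
               Chain R c O y′ z → Chain R c O x z
  Chain-join done x<y′ y′≤ Oy′ ch′ = step x<y′ y′≤ Oy′ ch′
  Chain-join {y′ = y′} (step {y = u} x<u u≤ Ou ch) x<y′ y′≤ Oy′ ch′ with y′ ≤? u
  ... | yes y′≤u = step x<y′ (≤-trans y′≤u u≤) Oy′ ch′
  ... | no  y′≰u = step x<u u≤ Ou (Chain-join ch (≰⇒> y′≰u) y′≤ Oy′ ch′)

  Chain-truncate : ∀ {c O O′ x z w} → x ≤ w → w ≤ z → O′ w → (∀ {p} → p ≤ w → O p → O′ p) →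
                   Chain R c O x z → Chain R c O′ x w
  Chain-truncate x≤w w≤z O′w f done with ≤-antisym x≤w w≤z
  ... | refl = done
  Chain-truncate {x = x} {w = w} x≤w w≤z O′w f (step {y = y} x<y y≤ Oy ch) with y ≤? w
  ... | yes y≤w = step x<y y≤ (f y≤w Oy) (Chain-truncate y≤w w≤z O′w f ch)
  ... | no  y≰w with x ≟ w
  ...   | yes refl = done
  ...   | no  x≢w  = step (≤∧≢⇒< x≤w x≢w) (≤-trans (<⇒≤ (≰⇒> y≰w)) y≤) O′w done

  Occ-resp-≈ : ∀ {P Q U p} → P ≈ Q → Occ R P U p → Occ R Q U p
  Occ-resp-≈ P≈Q occ rewrite sym (≈-len P≈Q) with occ
  ... | 1≤p , p≤ , |P|≤ , P≈ = 1≤p , p≤ , |P|≤ , ≈-trans (≈-sym P≈Q) P≈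

  Cov-resp-≈ : ∀ {C D U} → C ≈ D → Cov R C U → Cov R D U
  Cov-resp-≈ {U = U} C≈D (occ₁ , ch) =
    Occ-resp-≈ C≈D occ₁ ,
    subst (λ n → Chain R n (Occ R _ U) 1 (length U ∸ n + 1)) (≈-len C≈D) (Chain-map (Occ-resp-≈ C≈D) ch)

  Cov⇒length≤ : ∀ {C U} → Cov R C U → length C ≤ length U
  Cov⇒length≤ ((_ , _ , |C|≤|U| , _) , _) = |C|≤|U|

  Cov⇒≈pre : ∀ {C U} → Cov R C U → C ≈ pre U (length C)
  Cov⇒≈pre ((_ , _ , _ , C≈) , _) = C≈

  Cov⇒IsBorder : ∀ {C U} → Cov R C U → IsBorder R C U
  Cov⇒IsBorder {C} {U} cov@(occ₁ , ch) with Chain-last occ₁ ch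
  ... | _ , _ , |C|≤|U| , C≈suffix =
    C≈prefix , ≈-trans (≈-sym C≈prefix) (subst (λ n → C ≈ sub U (length U ∸ length C + 1) n)
                                               (m∸n+1+n∸1≡m |C|≤|U|) C≈suffix)
    where
    C≈prefix : C ≈ pre U (length C)
    C≈prefix = Cov⇒≈pre cov

  Cov⇒LSeed : ∀ {C U} → Cov R C U → 1 ≤ length C → LSeed R C U
  Cov⇒LSeed {C} {U} cov 1≤|C| =
    0 , 0 , z≤n , 1≤|C| , subst (Cov R C) (sym (pre-length U)) cov ,
    subst ([] ≈_) (sym (sub-empty U (≤-reflexive (+-comm 1 (length U))))) ≈-refl

  module _ (T : List A) where

    -- An occurrence of P in T[:m] at p, with the matched factor read off T itself.
    OccIn : ℕ → List A → ℕ → Set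
    OccIn m P p = (1 ≤ p) × (p + length P ≤ suc m) × (P ≈ sub T p (p + length P ∸ 1))

    CoverChain : ℕ → List A → Set
    CoverChain m S = Chain R (length S) (OccIn m S) 1 (m ∸ length S + 1)

    Occ⇒OccIn : ∀ {m P p} → m ≤ length T → Occ R P (pre T m) p → OccIn m P p
    Occ⇒OccIn {m} {P} {p} m≤|T| occ rewrite length-pre T m≤|T| with occ
    ... | 1≤p , p≤ , |P|≤m , P≈ = 1≤p , end≤ , subst (P ≈_) (sub-pre T 1≤p (∸-monoˡ-≤ 1 end≤)) P≈
      where
      end≤ : p + length P ≤ suc m
      end≤ = ≤-trans (+-monoˡ-≤ (length P) p≤) (≤-reflexive (m∸n+1+n≡1+m |P|≤m))

    OccIn⇒Occ : ∀ {m P p} → m ≤ length T → OccIn m P p → Occ R P (pre T m) p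
    OccIn⇒Occ {m} {P} {suc p} m≤|T| (1≤p , s≤s end≤ , P≈) rewrite length-pre T m≤|T| =
      1≤p ,
      ≤-trans (s≤s (m+n≤o⇒m≤o∸n p end≤)) (≤-reflexive (+-comm 1 (m ∸ length P))) ,
      m+n≤o⇒n≤o p end≤ ,
      subst (P ≈_) (sym (sub-pre T 1≤p (∸-monoˡ-≤ 1 (s≤s end≤)))) P≈

    OccIn-weaken : ∀ {m m′ P p} → m ≤ m′ → OccIn m P p → OccIn m′ P p
    OccIn-weaken m≤m′ (1≤p , end≤ , P≈) = 1≤p , ≤-trans end≤ (s≤s m≤m′) , P≈

    ≈suffix⇒OccIn : ∀ {m S} → length S ≤ m → S ≈ sub T (m ∸ length S + 1) m →
                    OccIn m S (m ∸ length S + 1)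
    ≈suffix⇒OccIn {m} {S} |S|≤m S≈ =
      m≤n+m 1 (m ∸ length S) , ≤-reflexive (m∸n+1+n≡1+m |S|≤m) ,
      subst (λ n → S ≈ sub T (m ∸ length S + 1) n) (sym (m∸n+1+n∸1≡m |S|≤m)) S≈

    OccIn⇒≈suffix : ∀ {m S} → length S ≤ m → OccIn m S (m ∸ length S + 1) →
                    S ≈ sub T (m ∸ length S + 1) m
    OccIn⇒≈suffix {m} {S} |S|≤m (_ , _ , S≈) =
      subst (λ n → S ≈ sub T (m ∸ length S + 1) n) (m∸n+1+n∸1≡m |S|≤m) S≈

    Cov⇒CoverChain : ∀ {m S} → m ≤ length T → Cov R S (pre T m) → CoverChain m S
    Cov⇒CoverChain {m} {S} m≤|T| (_ , ch) =
      subst (λ n → Chain R (length S) (OccIn m S) 1 (n ∸ length S + 1)) (length-pre T m≤|T|)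
            (Chain-map (Occ⇒OccIn m≤|T|) ch)

    CoverChain⇒Cov : ∀ {m S} → m ≤ length T → OccIn m S 1 → CoverChain m S → Cov R S (pre T m)
    CoverChain⇒Cov {m} {S} m≤|T| occ₁ ch =
      OccIn⇒Occ m≤|T| occ₁ ,
      Chain-map (OccIn⇒Occ m≤|T|)
        (subst (λ n → Chain R (length S) (OccIn m S) 1 (n ∸ length S + 1)) (sym (length-pre T m≤|T|)) ch)

    BorderLen⇒sub-shift : ∀ {i b} → i ≤ length T → BorderLen R T i b → ∀ {p q} →
                          1 ≤ p → p ≤ q → q ≤ b → sub T p q ≈ sub T (p + (i ∸ b)) (q + (i ∸ b))
    BorderLen⇒sub-shift {i} {b} i≤|T| (B , refl , b<i , _ , pre≈suf) {suc p} {q} 1≤p p≤q q≤b =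
      subst₂ _≈_ pre-side suf-side (≈-sub pre≈suf (suc p) q 1≤p p≤q q≤|pre|)
      where
      b≤i = <⇒≤ b<i
      d = i ∸ b
      Ti = pre T i
      q≤|pre| : q ≤ length (pre Ti b)
      q≤|pre| = subst (q ≤_) (sym (trans (cong length (pre-pre T b≤i)) (length-pre T (≤-trans b≤i i≤|T|)))) q≤b
      pre-side : sub (pre Ti b) (suc p) q ≡ sub T (suc p) q
      pre-side = trans (cong (λ X → sub X (suc p) q) (pre-pre T b≤i)) (sub-pre T 1≤p q≤b)
      suf≡ : suf Ti (length Ti ∸ b + 1) ≡ sub T (suc d) i
      suf≡ = trans (cong (suf Ti) (trans (cong (λ n → n ∸ b + 1) (length-pre T i≤|T|)) (+-comm d 1)))
                   (suf-pre T {p = suc d} (s≤s z≤n) i≤|T|)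
      q+d≤i : q + d ≤ i
      q+d≤i = ≤-trans (+-monoˡ-≤ d q≤b) (≤-reflexive (m+[n∸m]≡n b≤i))
      suf-side : sub (suf Ti (length Ti ∸ b + 1)) (suc p) q ≡ sub T (suc p + d) (q + d)
      suf-side = trans (cong (λ X → sub X (suc p) q) suf≡)
                       (trans (sub-sub T d i p q q+d≤i) (cong₂ (sub T) (cong suc (+-comm d p)) (+-comm d q)))

    OccIn-shift : ∀ {i b P p} → i ≤ length T → BorderLen R T i b → 1 ≤ length P →
                  OccIn b P p → OccIn i P (p + (i ∸ b))
    OccIn-shift {i} {b} {P} {suc p} i≤|T| border@(_ , _ , b<i , _) 1≤|P| (1≤p , s≤s end≤b , P≈) =
      s≤s z≤n , s≤s end≤i ,
      ≈-trans P≈ (subst (λ n → sub T (suc p) (p + L) ≈ sub T (suc p + d) n) end≡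
                        (BorderLen⇒sub-shift i≤|T| border 1≤p p<p+L end≤b))
      where
      L = length P
      d = i ∸ b
      p<p+L : suc p ≤ p + L
      p<p+L = subst (_≤ p + L) (+-comm p 1) (+-monoʳ-≤ p 1≤|P|)
      swap : ∀ x y z → x + y + z ≡ x + z + y
      swap x y z = trans (+-assoc x y z) (trans (cong (x +_) (+-comm y z)) (sym (+-assoc x z y)))
      end≡ : p + L + d ≡ suc p + d + L ∸ 1
      end≡ = swap p L d
      end≤i : p + d + L ≤ i
      end≤i = ≤-trans (≤-reflexive (swap p d L))
                      (≤-trans (+-monoˡ-≤ d end≤b) (≤-reflexive (m+[n∸m]≡n (<⇒≤ b<i))))

    LSeed-covering-border⇒Cov : ∀ {i b S} → i ≤ length T → BorderLen R T i b →
                                LSeed R S (pre T i) → Cov R S (pre T b) → Cov R S (pre T i)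
    LSeed-covering-border⇒Cov {i} {b} {S} i≤|T| border@(_ , _ , b<i , _)
                              (k , l , k≤l , l<|S| , cov[i∸k] , _) cov[b] =
      CoverChain⇒Cov i≤|T| (OccIn-weaken b≤i occ₁) joined
      where
      L = length S
      d = i ∸ b
      b≤i = <⇒≤ b<i
      b≤|T| = ≤-trans b≤i i≤|T|
      occ₁ : OccIn b S 1
      occ₁ = Occ⇒OccIn b≤|T| (proj₁ cov[b])
      L≤b : L ≤ b
      L≤b = subst (L ≤_) (length-pre T b≤|T|) (Cov⇒length≤ cov[b])
      1≤L : 1 ≤ L
      1≤L = ≤-trans (s≤s z≤n) l<|S|
      k≤b : k ≤ b
      k≤b = ≤-trans k≤l (≤-trans (<⇒≤ l<|S|) L≤b)
      pre[i∸k] : pre (pre T i) (length (pre T i) ∸ k) ≡ pre T (i ∸ k)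
      pre[i∸k] = trans (cong (λ n → pre (pre T i) (n ∸ k)) (length-pre T i≤|T|)) (pre-pre T (m∸n≤m i k))
      left : Chain R L (OccIn i S) 1 (i ∸ k ∸ L + 1)
      left = Chain-map (OccIn-weaken (m∸n≤m i k))
               (Cov⇒CoverChain (≤-trans (m∸n≤m i k) i≤|T|) (subst (Cov R S) pre[i∸k] cov[i∸k]))
      right : Chain R L (OccIn i S) (1 + d) (b ∸ L + 1 + d)
      right = Chain-shift d (OccIn-shift i≤|T| border 1≤L) (Cov⇒CoverChain b≤|T| cov[b])
      joined : CoverChain i S
      joined = subst (Chain R L (OccIn i S) 1) (m∸n+1+[o∸m]≡o∸n+1 L≤b b≤i)
                 (Chain-join left (s≤s (m<n⇒0<n∸m b<i)) (1+[o∸n]≤o∸m∸p+1+p i L k≤b)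
                             (OccIn-shift i≤|T| border 1≤L occ₁) right)

    Cov-restrict-to-border : ∀ {i b S} → i ≤ length T → BorderLen R T i b →
                             1 ≤ length S → length S ≤ b → Cov R S (pre T i) → Cov R S (pre T b)
    Cov-restrict-to-border {i} {b} {S} i≤|T| border@(_ , _ , b<i , _) 1≤L L≤b cov =
      CoverChain⇒Cov b≤|T| (restrict 1≤w occ₁) (Chain-truncate 1≤w w≤last occ-w restrict chain)
      where
      L = length S
      w = b ∸ L + 1
      b≤i = <⇒≤ b<i
      b≤|T| = ≤-trans b≤i i≤|T|
      L≤i = ≤-trans L≤b b≤i
      1≤w : 1 ≤ w
      1≤w = m≤n+m 1 (b ∸ L)
      w≤last : w ≤ i ∸ L + 1
      w≤last = +-monoˡ-≤ 1 (∸-monoˡ-≤ L b≤i)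
      chain : CoverChain i S
      chain = Cov⇒CoverChain i≤|T| cov
      occ₁ : OccIn i S 1
      occ₁ = Occ⇒OccIn i≤|T| (proj₁ cov)
      restrict : ∀ {p} → p ≤ w → OccIn i S p → OccIn b S p
      restrict p≤w (1≤p , _ , S≈) = 1≤p , ≤-trans (+-monoˡ-≤ L p≤w) (≤-reflexive (m∸n+1+n≡1+m L≤b)) , S≈
      shifted : sub T w b ≈ sub T (i ∸ L + 1) i
      shifted = subst₂ (λ x y → sub T w b ≈ sub T x y) (m∸n+1+[o∸m]≡o∸n+1 L≤b b≤i) (m+[n∸m]≡n b≤i)
                       (BorderLen⇒sub-shift i≤|T| border 1≤w (m∸n+1≤m 1≤L L≤b) ≤-refl)
      occ-w : OccIn b S w
      occ-w = ≈suffix⇒OccIn L≤b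
                (≈-trans (OccIn⇒≈suffix L≤i (Chain-last occ₁ chain)) (≈-sym shifted))

    LLSCSet⇒LCoverSet : ∀ {i b s} → i ≤ length T → BorderLen R T i b →
                        LLSCSet R T i b s → LCoverSet R T i s
    LLSCSet⇒LCoverSet _ _ (inj₁ s≡0) = inj₁ s≡0
    LLSCSet⇒LCoverSet {i} {b} {s} i≤|T| border@(_ , _ , b<i , _) (inj₂ (s≤|T| , seed , cov[b])) =
      inj₂ (pre T s , length-pre T s≤|T| , s<i , LSeed-covering-border⇒Cov i≤|T| border seed cov[b])
      where
      b≤|T| = ≤-trans (<⇒≤ b<i) i≤|T|
      s<i : s < i
      s<i = ≤-<-trans (subst₂ _≤_ (length-pre T s≤|T|) (length-pre T b≤|T|) (Cov⇒length≤ cov[b])) b<i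

    LCoverSet⇒LLSCSet : ∀ {i b c} → i ≤ length T → IsMax (BorderLen R T i) b →
                        LCoverSet R T i c → LLSCSet R T i b c
    LCoverSet⇒LLSCSet _ _ (inj₁ c≡0) = inj₁ c≡0
    LCoverSet⇒LLSCSet {c = zero} _ _ (inj₂ _) = inj₁ refl
    LCoverSet⇒LLSCSet {i} {b} {c@(suc _)} i≤|T| (border , longest) (inj₂ (C , |C|≡c , c<i , cov[C])) =
      inj₂ (c≤|T| , Cov⇒LSeed cov 1≤L , Cov-restrict-to-border i≤|T| border 1≤L L≤b cov)
      where
      c≤|T| = ≤-trans (<⇒≤ c<i) i≤|T|
      S = pre T c
      |S|≡c : length S ≡ c
      |S|≡c = length-pre T c≤|T|
      1≤L : 1 ≤ length S
      1≤L = subst (1 ≤_) (sym |S|≡c) (s≤s z≤n)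
      cov : Cov R S (pre T i)
      cov = Cov-resp-≈ (subst (C ≈_) prefix (Cov⇒≈pre cov[C])) cov[C]
        where
        prefix : pre (pre T i) (length C) ≡ S
        prefix = trans (cong (pre (pre T i)) |C|≡c) (pre-pre T (<⇒≤ c<i))
      L≤b : length S ≤ b
      L≤b = subst (_≤ b) (sym |S|≡c) (longest c (S , |S|≡c , c<i , Cov⇒IsBorder cov))

lemma14 : {A : Set} (R : SCER A) (T : List A) (i b c s : ℕ) →
    1 ≤ i → i ≤ length T →
    IsMax (BorderLen R T i) b →
    IsMax (LCoverSet R T i) c →
    IsMax (LLSCSet R T i b) s →
    c ≡ s
lemma14 R T i b c s _ i≤|T| (border , longest) (cover , longest-cover) (seed , longest-seed) =
  ≤-antisym (longest-seed c (LCoverSet⇒LLSCSet R T i≤|T| (border , longest) cover))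
            (longest-cover s (LLSCSet⇒LCoverSet R T i≤|T| border seed))
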